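{- The polynomials $f_n$ satisfy $f_0=1$, $f_1=m_0\lambda$, and $f_{n+1}=m_n\lambda f_n+f_{n-1}$ for all $n\ge1$.
   Context: Let $\mathcal{I}$ be the set of finite subsets $I\subset\mathbf{N}_0=\{0,1,2,\dots\}$ such that $i\equiv|[0,i)\cap I|\pmod 2$ for every $i\in I$. For $n\ge0$ define the polynomial in the variables $\lambda,m_0,m_1,\dots$ $$f_n=f_n(\lambda,m_0,\dots,m_{n-1})=\sum_{\substack{0\le k\le n\\ k\equiv n\ (\mathrm{mod}\ 2)}}\Big(\sum_{\substack{I\in\mathcal{I},\ I\subseteq[0,n)\\ |I|=k}}\prod_{i\in I}m_i\Big)\lambda^k .$$ -}

module Defs where

open import Level using (Level)
open import Data.Nat as ℕ using (ℕ; zero; suc; _%_)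
open import Data.Fin as Fin using (Fin; toℕ)
open import Data.Fin.Properties using (all?)
open import Data.Fin.Subset using (Subset; inside; outside; _∈_; ∣_∣)
open import Data.Fin.Subset.Properties using (_∈?_)
open import Data.List using (List; []; _∷_; _++_; map; filter; foldr; upTo)
open import Data.Vec using (Vec; []; _∷_)
open import Relation.Binary.PropositionalEquality using (_≡_)
open import Relation.Nullary using (Dec)
open import Relation.Nullary.Decidable using (_→-dec_; _×-dec_)
open import Algebra.Bundles using (CommutativeRing)

allSubsets : (n : ℕ) → List (Subset n)
allSubsets zero = [] ∷ []
allSubsets (suc n) = map (inside ∷_) (allSubsets n) ++ map (outside ∷_) (allSubsets n)

countBelow : {n : ℕ} → Subset n → Fin n → ℕ
countBelow (_ ∷ p) Fin.zero = 0
countBelow (inside ∷ p) (Fin.suc i) = suc (countBelow p i)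
countBelow (outside ∷ p) (Fin.suc i) = countBelow p i

-- Membership in 𝓘 for a subset of [0,n):
-- for every i ∈ I, i ≡ |[0,i) ∩ I| (mod 2).
-- (This condition only involves elements below i, so it is the same as
-- the condition for I viewed as a finite subset of ℕ.)
InCalI : {n : ℕ} → Subset n → Set
InCalI {n} I = (i : Fin n) → i ∈ I → toℕ i % 2 ≡ countBelow I i % 2

inCalI? : {n : ℕ} → (I : Subset n) → Dec (InCalI I)
inCalI? I = all? (λ i → (i ∈? I) →-dec (toℕ i % 2 ℕ.≟ countBelow I i % 2))

calI-card : (n k : ℕ) → List (Subset n)
calI-card n k = filter (λ I → inCalI? I ×-dec (∣ I ∣ ℕ.≟ k)) (allSubsets n)

module _ {c ℓ : Level} (R : CommutativeRing c ℓ) where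
  open CommutativeRing R

  sumR : List Carrier → Carrier
  sumR = foldr _+_ 0#

  powR : Carrier → ℕ → Carrier
  powR x zero = 1#
  powR x (suc k) = x * powR x k

  prodM : {n : ℕ} → (ℕ → Carrier) → Subset n → Carrier
  prodM m [] = 1#
  prodM m (inside ∷ p) = m 0 * prodM (λ j → m (suc j)) p
  prodM m (outside ∷ p) = prodM (λ j → m (suc j)) p

  -- f_n(λ, m_0, …, m_{n-1}) evaluated in R at λ = t and m_i = m i:
  -- Σ_{0 ≤ k ≤ n, k ≡ n mod 2} ( Σ_{I ∈ 𝓘, I ⊆ [0,n), |I| = k} ∏_{i∈I} m_i ) λ^k
  f : Carrier → (ℕ → Carrier) → ℕ → Carrier
  f t m n =
    sumR (map (λ k → sumR (map (prodM m) (calI-card n k)) * powR t k)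
              (filter (λ k → k % 2 ℕ.≟ n % 2) (upTo (suc n))))

-- Call I ⊆ [0,n) admissible when I ∈ 𝓘 and |I| ≡ n (mod 2). Then before each element of I,
-- and in total, an even number of positions of [0,n) are missing from I, so the gaps of I
-- are runs of even length: I is the set of monomers of a tiling of [0,n) by monomers and
-- dimers. Regrouping the terms of f_n by k, f_n sums m^I λ^|I| over the admissible I, and
-- removing the first tile gives f_{n+2}(m) = m_0 λ f_{n+1}(m_{·+1}) + f_n(m_{·+2}).
-- The stated recursion, which removes the last tile instead, follows by induction on n.
module Submission where

open import Defs
open import Level using (Level)
open import Data.Nat using (ℕ; zero; suc; _≤_; _<_; _∸_; _%_; _≟_; s≤s)
open import Data.Product using (_×_; _,_; proj₁; proj₂)
open import Algebra.Bundles using (CommutativeRing)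
open import Data.Nat.DivMod using (%-distribˡ-+)
open import Data.Nat.Properties using (suc-injective)
open import Data.Fin using (Fin; toℕ)
open import Data.Fin.Subset using (Subset; inside; outside; ∣_∣)
open import Data.Fin.Subset.Properties using (∣p∣≤n)
open import Data.Vec using ([]; _∷_; here; there)
open import Data.List using (List; []; _∷_; _++_; map; filter; upTo)
open import Data.List.Properties using (map-∘; map-upTo; map-applyUpTo)
open import Data.Bool using (true; false; if_then_else_)
import Data.Product as Product
open import Data.Maybe using (nothing)
open import Function using (_∘_; _⇔_; mk⇔; Equivalence)
open import Relation.Nullary using (Dec; yes; no; does; ¬_)
open import Relation.Nullary.Decidable using (dec-true; dec-false; _×-dec_)
open import Relation.Unary using (Pred; Decidable)
open import Relation.Binary.PropositionalEquality as ≡ using (_≡_; _≢_)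
open import Tactic.RingSolver.Core.AlmostCommutativeRing using (fromCommutativeRing)

private
  variable
    n : ℕ
    p : Subset n

suc-%2-cong : ∀ a b → a % 2 ≡ b % 2 → suc a % 2 ≡ suc b % 2
suc-%2-cong a b eq = ≡.trans (%-distribˡ-+ 1 a 2)
  (≡.trans (≡.cong (λ r → suc r % 2) eq) (≡.sym (%-distribˡ-+ 1 b 2)))

-- (2 + a) % 2 reduces to a % 2.
suc-%2-injective : ∀ a b → suc a % 2 ≡ suc b % 2 → a % 2 ≡ b % 2
suc-%2-injective a b = suc-%2-cong (suc a) (suc b)

InCalI-inside⁺ : InCalI p → InCalI (inside ∷ p)
InCalI-inside⁺ I∈𝓘 Fin.zero here = ≡.refl
InCalI-inside⁺ {p = p} I∈𝓘 (Fin.suc i) (there i∈p) =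
  suc-%2-cong (toℕ i) (countBelow p i) (I∈𝓘 i i∈p)

InCalI-inside⁻ : InCalI (inside ∷ p) → InCalI p
InCalI-inside⁻ {p = p} I∈𝓘 i i∈p =
  suc-%2-injective (toℕ i) (countBelow p i) (I∈𝓘 (Fin.suc i) (there i∈p))

InCalI-outside²⁺ : InCalI p → InCalI (outside ∷ outside ∷ p)
InCalI-outside²⁺ I∈𝓘 (Fin.suc (Fin.suc i)) (there (there i∈p)) = I∈𝓘 i i∈p

InCalI-outside²⁻ : InCalI (outside ∷ outside ∷ p) → InCalI p
InCalI-outside²⁻ I∈𝓘 i i∈p = I∈𝓘 (Fin.suc (Fin.suc i)) (there (there i∈p))

¬InCalI-outside-inside : ¬ InCalI (outside ∷ inside ∷ p)
¬InCalI-outside-inside I∈𝓘 with I∈𝓘 (Fin.suc Fin.zero) (there here)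
... | ()

Admissible : Subset n → Set
Admissible {n} I = InCalI I × ∣ I ∣ % 2 ≡ n % 2

admissible? : (I : Subset n) → Dec (Admissible I)
admissible? {n} I = inCalI? I ×-dec (∣ I ∣ % 2 ≟ n % 2)

admissible-[] : Admissible []
admissible-[] = (λ ()) , ≡.refl

¬admissible-outside : ¬ Admissible (outside ∷ [])
¬admissible-outside (_ , ())

admissible-inside : Admissible (inside ∷ p) ⇔ Admissible p
admissible-inside {n} {p} = mk⇔ (Product.map InCalI-inside⁻ (suc-%2-injective ∣ p ∣ n))
                                (Product.map InCalI-inside⁺ (suc-%2-cong ∣ p ∣ n))

admissible-outside² : Admissible (outside ∷ outside ∷ p) ⇔ Admissible p
admissible-outside² = mk⇔ (Product.map₁ InCalI-outside²⁻) (Product.map₁ InCalI-outside²⁺)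

¬admissible-outside-inside : ¬ Admissible (outside ∷ inside ∷ p)
¬admissible-outside-inside = ¬InCalI-outside-inside ∘ proj₁

module RingSums {c ℓ : Level} (R : CommutativeRing c ℓ) where
  open CommutativeRing R

  open import Relation.Binary.Reasoning.Setoid setoid
  open import Algebra.Properties.CommutativeSemigroup +-commutativeSemigroup
    using () renaming (interchange to +-interchange)

  ∑ : ∀ {a} {A : Set a} → List A → (A → Carrier) → Carrier
  ∑ xs g = sumR R (map g xs)

  syntax ∑ xs (λ x → g) = ∑[ x ← xs ] g

  ∑-cong : ∀ {a} {A : Set a} {g h : A → Carrier} xs → (∀ x → g x ≈ h x) → ∑ xs g ≈ ∑ xs h
  ∑-cong []       g≈h = refl
  ∑-cong (x ∷ xs) g≈h = +-cong (g≈h x) (∑-cong xs g≈h)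

  ∑-zero : ∀ {a} {A : Set a} {g : A → Carrier} xs → (∀ x → g x ≈ 0#) → ∑ xs g ≈ 0#
  ∑-zero []       g≈0 = refl
  ∑-zero (x ∷ xs) g≈0 = trans (+-cong (g≈0 x) (∑-zero xs g≈0)) (+-identityˡ 0#)

  ∑-++ : ∀ {a} {A : Set a} (g : A → Carrier) xs ys → ∑ (xs ++ ys) g ≈ ∑ xs g + ∑ ys g
  ∑-++ g []       ys = sym (+-identityˡ _)
  ∑-++ g (x ∷ xs) ys = trans (+-congˡ (∑-++ g xs ys)) (sym (+-assoc _ _ _))

  ∑-map : ∀ {a b} {A : Set a} {B : Set b} (g : B → Carrier) (h : A → B) xs →
          ∑ (map h xs) g ≡ ∑[ x ← xs ] g (h x)
  ∑-map g h xs = ≡.cong (sumR R) (≡.sym (map-∘ xs))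

  ∑-+ : ∀ {a} {A : Set a} (g h : A → Carrier) xs → ∑[ x ← xs ] (g x + h x) ≈ ∑ xs g + ∑ xs h
  ∑-+ g h []       = sym (+-identityˡ 0#)
  ∑-+ g h (x ∷ xs) = trans (+-congˡ (∑-+ g h xs)) (+-interchange _ _ _ _)

  ∑-*ˡ : ∀ {a} {A : Set a} (g : A → Carrier) u xs → u * ∑ xs g ≈ ∑[ x ← xs ] (u * g x)
  ∑-*ˡ g u []       = zeroʳ u
  ∑-*ˡ g u (x ∷ xs) = trans (distribˡ u _ _) (+-congˡ (∑-*ˡ g u xs))

  ∑-*ʳ : ∀ {a} {A : Set a} (g : A → Carrier) u xs → ∑ xs g * u ≈ ∑[ x ← xs ] (g x * u)
  ∑-*ʳ g u []       = zeroˡ u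
  ∑-*ʳ g u (x ∷ xs) = trans (distribʳ u _ _) (+-congˡ (∑-*ʳ g u xs))

  ∑-comm : ∀ {a b} {A : Set a} {B : Set b} (g : A → B → Carrier) xs ys →
           ∑[ x ← xs ] ∑[ y ← ys ] g x y ≈ ∑[ y ← ys ] ∑[ x ← xs ] g x y
  ∑-comm g []       ys = sym (∑-zero ys (λ _ → refl))
  ∑-comm g (x ∷ xs) ys = trans (+-congˡ (∑-comm g xs ys)) (sym (∑-+ (g x) _ ys))

  ∑-upTo-suc : ∀ (φ : ℕ → Carrier) N → ∑ (upTo (suc N)) φ ≡ φ 0 + ∑ (upTo N) (φ ∘ suc)
  ∑-upTo-suc φ N = ≡.cong (λ xs → φ 0 + sumR R xs)
    (≡.trans (map-applyUpTo suc φ N) (≡.sym (map-upTo (φ ∘ suc) N)))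

  ∑-upTo-single : ∀ (φ : ℕ → Carrier) {N} c → c < N → (∀ k → k ≢ c → φ k ≈ 0#) →
                  ∑ (upTo N) φ ≈ φ c
  ∑-upTo-single φ {suc N} zero c<N φ≈0 = begin
    ∑ (upTo (suc N)) φ         ≡⟨ ∑-upTo-suc φ N ⟩
    φ 0 + ∑ (upTo N) (φ ∘ suc) ≈⟨ +-congˡ (∑-zero (upTo N) (λ k → φ≈0 (suc k) λ ())) ⟩
    φ 0 + 0#                   ≈⟨ +-identityʳ _ ⟩
    φ 0                        ∎
  ∑-upTo-single φ {suc N} (suc c) (s≤s c<N) φ≈0 = begin
    ∑ (upTo (suc N)) φ         ≡⟨ ∑-upTo-suc φ N ⟩
    φ 0 + ∑ (upTo N) (φ ∘ suc) ≈⟨ +-cong (φ≈0 0 λ ()) (∑-upTo-single (φ ∘ suc) c c<N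
                                   λ k k≢c → φ≈0 (suc k) (k≢c ∘ suc-injective)) ⟩
    0# + φ (suc c)             ≈⟨ +-identityˡ _ ⟩
    φ (suc c)                  ∎

  ⟦_⟧_ : ∀ {p} {P : Set p} → Dec P → Carrier → Carrier
  ⟦ P? ⟧ x = if does P? then x else 0#

  module _ {p} {P : Set p} (P? : Dec P) where

    ⟦⟧-congʳ : ∀ {x y} → x ≈ y → ⟦ P? ⟧ x ≈ ⟦ P? ⟧ y
    ⟦⟧-congʳ x≈y with does P?
    ... | true  = x≈y
    ... | false = refl

    ⟦⟧-true : ∀ {x} → P → ⟦ P? ⟧ x ≈ x
    ⟦⟧-true p rewrite dec-true P? p = refl

    ⟦⟧-false : ∀ {x} → ¬ P → ⟦ P? ⟧ x ≈ 0#
    ⟦⟧-false ¬p rewrite dec-false P? ¬p = refl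

    ⟦⟧-zero : ⟦ P? ⟧ 0# ≈ 0#
    ⟦⟧-zero with does P?
    ... | true  = refl
    ... | false = refl

    ⟦⟧-*ˡ : ∀ u x → ⟦ P? ⟧ (u * x) ≈ u * ⟦ P? ⟧ x
    ⟦⟧-*ˡ u x with does P?
    ... | true  = refl
    ... | false = sym (zeroʳ u)

    ⟦⟧-∑ : ∀ {a} {A : Set a} (g : A → Carrier) xs → ⟦ P? ⟧ ∑ xs g ≈ ∑[ x ← xs ] ⟦ P? ⟧ g x
    ⟦⟧-∑ g xs with does P?
    ... | true  = refl
    ... | false = sym (∑-zero xs (λ _ → refl))

  ⟦⟧-cong : ∀ {p q} {P : Set p} {Q : Set q} (P? : Dec P) (Q? : Dec Q) →
            P ⇔ Q → ∀ {x y} → x ≈ y → ⟦ P? ⟧ x ≈ ⟦ Q? ⟧ y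
  ⟦⟧-cong (yes p) Q? P⇔Q x≈y = trans x≈y (sym (⟦⟧-true Q? (Equivalence.to P⇔Q p)))
  ⟦⟧-cong (no ¬p) Q? P⇔Q x≈y = sym (⟦⟧-false Q? (¬p ∘ Equivalence.from P⇔Q))

  ⟦⟧-×-dec : ∀ {p q} {P : Set p} {Q : Set q} (P? : Dec P) (Q? : Dec Q) x y →
             ⟦ Q? ⟧ (⟦ P? ⟧ x * y) ≈ ⟦ P? ×-dec Q? ⟧ (x * y)
  ⟦⟧-×-dec (yes _) (yes _) x y = refl
  ⟦⟧-×-dec (yes _) (no _)  x y = refl
  ⟦⟧-×-dec (no _)  (yes _) x y = zeroˡ y
  ⟦⟧-×-dec (no _)  (no _)  x y = refl

  ∑-filter : ∀ {a p} {A : Set a} {P : Pred A p} (P? : Decidable P) (g : A → Carrier) xs →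
             ∑ (filter P? xs) g ≈ ∑[ x ← xs ] ⟦ P? x ⟧ g x
  ∑-filter P? g []       = refl
  ∑-filter P? g (x ∷ xs) with does (P? x)
  ... | true  = +-congˡ (∑-filter P? g xs)
  ... | false = trans (∑-filter P? g xs) (sym (+-identityˡ _))

module _ {c ℓ : Level} (R : CommutativeRing c ℓ) where
  open CommutativeRing R
  open RingSums R
  open import Relation.Binary.Reasoning.Setoid setoid
  open import Tactic.RingSolver.NonReflective (fromCommutativeRing R (λ _ → nothing))
  open import Algebra.Properties.CommutativeSemigroup *-commutativeSemigroup
    using () renaming (interchange to *-interchange)

  module Continuant (t : Carrier) (K : ℕ → (ℕ → Carrier) → Carrier)
    (K-0 : ∀ m → K 0 m ≈ 1#)
    (K-1 : ∀ m → K 1 m ≈ m 0 * t)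
    (K-front : ∀ n m → K (suc (suc n)) m ≈ m 0 * t * K (suc n) (m ∘ suc) + K n (m ∘ suc ∘ suc))
    where

    K-1-front : ∀ m m′ → K 1 m ≈ m 0 * t * K 0 m′ + 0#
    K-1-front m m′ = begin
      K 1 m               ≈⟨ K-1 m ⟩
      m 0 * t             ≈⟨ *-identityʳ _ ⟨
      m 0 * t * 1#        ≈⟨ *-congˡ (K-0 m′) ⟨
      m 0 * t * K 0 m′    ≈⟨ +-identityʳ _ ⟨
      m 0 * t * K 0 m′ + 0# ∎

    -- Expanding K (n + 2) m by its first tile and then by its last one, or in the other
    -- order, gives the same four terms.
    K-back-step : ∀ n m {x b c d e} →
                  K (suc n) (m ∘ suc) ≈ x * t * b + c → K n (m ∘ suc ∘ suc) ≈ x * t * d + e →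
                  K (suc n) m ≈ m 0 * t * b + d → K n m ≈ m 0 * t * c + e →
                  K (suc (suc n)) m ≈ x * t * K (suc n) m + K n m
    K-back-step n m {x} {b} {c} {d} {e} eq₁ eq₂ eq₃ eq₄ = begin
      K (suc (suc n)) m                                         ≈⟨ K-front n m ⟩
      m 0 * t * K (suc n) (m ∘ suc) + K n (m ∘ suc ∘ suc)       ≈⟨ +-cong (*-congˡ eq₁) eq₂ ⟩
      m 0 * t * (x * t * b + c) + (x * t * d + e)               ≈⟨ exchange (m 0 * t) (x * t) b c d e ⟩
      x * t * (m 0 * t * b + d) + (m 0 * t * c + e)             ≈⟨ +-cong (*-congˡ eq₃) eq₄ ⟨
      x * t * K (suc n) m + K n m                               ∎
      where
      exchange : ∀ a x b c d e → a * (x * b + c) + (x * d + e) ≈ x * (a * b + d) + (a * c + e)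
      exchange = solve 6 (λ a x b c d e →
        (a ⊗ (x ⊗ b ⊕ c) ⊕ (x ⊗ d ⊕ e)) ⊜ (x ⊗ (a ⊗ b ⊕ d) ⊕ (a ⊗ c ⊕ e))) refl

    K-back : ∀ n m → K (suc (suc n)) m ≈ m (suc n) * t * K (suc n) m + K n m
    K-back zero m = begin
      K 2 m                                       ≈⟨ K-front 0 m ⟩
      m 0 * t * K 1 (m ∘ suc) + K 0 (m ∘ suc ∘ suc) ≈⟨ +-cong (*-congˡ (K-1 (m ∘ suc))) (K-0 _) ⟩
      m 0 * t * (m 1 * t) + 1#                    ≈⟨ +-congʳ (*-comm _ _) ⟩
      m 1 * t * (m 0 * t) + 1#                    ≈⟨ +-cong (*-congˡ (K-1 m)) (K-0 m) ⟨
      m 1 * t * K 1 m + K 0 m                     ∎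
    K-back (suc zero) m =
      K-back-step 1 m (K-back 0 (m ∘ suc)) (K-1-front (m ∘ suc ∘ suc) (m ∘ suc ∘ suc))
                      (K-front 0 m) (K-1-front m (m ∘ suc))
    K-back (suc (suc n)) m =
      K-back-step (suc (suc n)) m (K-back (suc n) (m ∘ suc)) (K-back n (m ∘ suc ∘ suc))
                                  (K-front (suc n) m) (K-front n m)

  ∑-allSubsets-suc : ∀ n (g : Subset (suc n) → Carrier) →
                     ∑ (allSubsets (suc n)) g
                       ≈ ∑[ I ← allSubsets n ] g (inside ∷ I) + ∑[ I ← allSubsets n ] g (outside ∷ I)
  ∑-allSubsets-suc n g = begin
    ∑ (map (inside ∷_) A ++ map (outside ∷_) A) g         ≈⟨ ∑-++ g (map (inside ∷_) A) _ ⟩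
    ∑ (map (inside ∷_) A) g + ∑ (map (outside ∷_) A) g    ≡⟨ ≡.cong₂ _+_ (∑-map g _ A) (∑-map g _ A) ⟩
    ∑[ I ← A ] g (inside ∷ I) + ∑[ I ← A ] g (outside ∷ I) ∎
    where A = allSubsets n

  module _ (t : Carrier) where

    weight : (ℕ → Carrier) → Subset n → Carrier
    weight m I = prodM R m I * powR R t ∣ I ∣

    admissibleSum : ℕ → (ℕ → Carrier) → Carrier
    admissibleSum n m = ∑[ I ← allSubsets n ] ⟦ admissible? I ⟧ weight m I

    f≈admissibleSum : ∀ m n → f R t m n ≈ admissibleSum n m
    f≈admissibleSum m n = begin
      f R t m n
        ≈⟨ ∑-filter Par? _ U ⟩
      ∑[ k ← U ] ⟦ Par? k ⟧ (∑ (filter (Card? k) S) (prodM R m) * powR R t k)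
        ≈⟨ ∑-cong U (λ k → ⟦⟧-congʳ (Par? k) (expand k)) ⟩
      ∑[ k ← U ] ⟦ Par? k ⟧ ∑[ I ← S ] (⟦ Card? k I ⟧ prodM R m I * powR R t k)
        ≈⟨ ∑-cong U (λ k → ⟦⟧-∑ (Par? k) _ S) ⟩
      ∑[ k ← U ] ∑[ I ← S ] term I k
        ≈⟨ ∑-comm (λ k I → term I k) U S ⟩
      ∑[ I ← S ] ∑[ k ← U ] term I k
        ≈⟨ ∑-cong S (λ I → ∑-upTo-single (term I) ∣ I ∣ (s≤s (∣p∣≤n I)) (off-diagonal I)) ⟩
      ∑[ I ← S ] term I ∣ I ∣
        ≈⟨ ∑-cong S diagonal ⟩
      admissibleSum n m ∎
      where
      S = allSubsets n
      U = upTo (suc n)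

      Par? : (k : ℕ) → Dec (k % 2 ≡ n % 2)
      Par? k = k % 2 ≟ n % 2

      Card? : (k : ℕ) (I : Subset n) → Dec (InCalI I × ∣ I ∣ ≡ k)
      Card? k I = inCalI? I ×-dec (∣ I ∣ ≟ k)

      term : Subset n → ℕ → Carrier
      term I k = ⟦ Par? k ⟧ (⟦ Card? k I ⟧ prodM R m I * powR R t k)

      expand : ∀ k → ∑ (filter (Card? k) S) (prodM R m) * powR R t k
                     ≈ ∑[ I ← S ] (⟦ Card? k I ⟧ prodM R m I * powR R t k)
      expand k = trans (*-congʳ (∑-filter (Card? k) (prodM R m) S)) (∑-*ʳ _ (powR R t k) S)

      off-diagonal : ∀ I k → k ≢ ∣ I ∣ → term I k ≈ 0#
      off-diagonal I k k≢∣I∣ = begin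
        term I k
          ≈⟨ ⟦⟧-congʳ (Par? k) (*-congʳ (⟦⟧-false (Card? k I) (k≢∣I∣ ∘ ≡.sym ∘ proj₂))) ⟩
        ⟦ Par? k ⟧ (0# * powR R t k) ≈⟨ ⟦⟧-congʳ (Par? k) (zeroˡ _) ⟩
        ⟦ Par? k ⟧ 0#                ≈⟨ ⟦⟧-zero (Par? k) ⟩
        0#                           ∎

      diagonal : ∀ I → term I ∣ I ∣ ≈ ⟦ admissible? I ⟧ weight m I
      diagonal I = begin
        term I ∣ I ∣
          ≈⟨ ⟦⟧-congʳ (Par? ∣ I ∣) (*-congʳ
               (⟦⟧-cong (Card? ∣ I ∣ I) (inCalI? I) (mk⇔ proj₁ (_, ≡.refl)) refl)) ⟩
        ⟦ Par? ∣ I ∣ ⟧ (⟦ inCalI? I ⟧ prodM R m I * powR R t ∣ I ∣)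
          ≈⟨ ⟦⟧-×-dec (inCalI? I) (Par? ∣ I ∣) _ _ ⟩
        ⟦ admissible? I ⟧ weight m I ∎

    weight-inside : ∀ m (I : Subset n) → weight m (inside ∷ I) ≈ m 0 * t * weight (m ∘ suc) I
    weight-inside m I = *-interchange (m 0) (prodM R (m ∘ suc) I) t (powR R t ∣ I ∣)

    ∑-admissible-inside : ∀ n m → ∑[ I ← allSubsets n ] ⟦ admissible? (inside ∷ I) ⟧ weight m (inside ∷ I)
                                   ≈ m 0 * t * admissibleSum n (m ∘ suc)
    ∑-admissible-inside n m = begin
      ∑[ I ← A ] ⟦ admissible? (inside ∷ I) ⟧ weight m (inside ∷ I)
        ≈⟨ ∑-cong A (λ I → ⟦⟧-cong (admissible? (inside ∷ I)) (admissible? I) admissible-inside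
                             (weight-inside m I)) ⟩
      ∑[ I ← A ] ⟦ admissible? I ⟧ (m 0 * t * weight (m ∘ suc) I)
        ≈⟨ ∑-cong A (λ I → ⟦⟧-*ˡ (admissible? I) (m 0 * t) _) ⟩
      ∑[ I ← A ] (m 0 * t * ⟦ admissible? I ⟧ weight (m ∘ suc) I)
        ≈⟨ ∑-*ˡ _ (m 0 * t) A ⟨
      m 0 * t * admissibleSum n (m ∘ suc) ∎
      where A = allSubsets n

    admissibleSum-0 : ∀ m → admissibleSum 0 m ≈ 1#
    admissibleSum-0 m = begin
      ⟦ admissible? [] ⟧ (1# * 1#) + 0# ≈⟨ +-identityʳ _ ⟩
      ⟦ admissible? [] ⟧ (1# * 1#)      ≈⟨ ⟦⟧-true (admissible? []) admissible-[] ⟩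
      1# * 1#                           ≈⟨ *-identityʳ 1# ⟩
      1#                                ∎

    admissibleSum-1 : ∀ m → admissibleSum 1 m ≈ m 0 * t
    admissibleSum-1 m = begin
      admissibleSum 1 m
        ≈⟨ ∑-allSubsets-suc 0 (λ I → ⟦ admissible? I ⟧ weight m I) ⟩
      ∑[ I ← allSubsets 0 ] ⟦ admissible? (inside ∷ I) ⟧ weight m (inside ∷ I) + (gap + 0#)
        ≈⟨ +-cong (∑-admissible-inside 0 m) (+-identityʳ gap) ⟩
      m 0 * t * admissibleSum 0 (m ∘ suc) + gap
        ≈⟨ +-cong (*-congˡ (admissibleSum-0 (m ∘ suc)))
                  (⟦⟧-false (admissible? (outside ∷ [])) {weight m (outside ∷ [])} ¬admissible-outside) ⟩
      m 0 * t * 1# + 0#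
        ≈⟨ trans (+-identityʳ _) (*-identityʳ _) ⟩
      m 0 * t ∎
      where gap = ⟦ admissible? (outside ∷ []) ⟧ weight m (outside ∷ [])

    admissibleSum-front : ∀ n m → admissibleSum (suc (suc n)) m
                                    ≈ m 0 * t * admissibleSum (suc n) (m ∘ suc)
                                      + admissibleSum n (m ∘ suc ∘ suc)
    admissibleSum-front n m = begin
      admissibleSum (suc (suc n)) m
        ≈⟨ ∑-allSubsets-suc (suc n) (λ I → ⟦ admissible? I ⟧ weight m I) ⟩
      ∑[ I ← allSubsets (suc n) ] ⟦ admissible? (inside ∷ I) ⟧ weight m (inside ∷ I)
        + ∑[ I ← allSubsets (suc n) ] ⟦ admissible? (outside ∷ I) ⟧ weight m (outside ∷ I)
        ≈⟨ +-cong (∑-admissible-inside (suc n) m)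
                  (∑-allSubsets-suc n (λ I → ⟦ admissible? (outside ∷ I) ⟧ weight m (outside ∷ I))) ⟩
      m 0 * t * admissibleSum (suc n) (m ∘ suc)
        + (∑[ I ← A ] ⟦ admissible? (outside ∷ inside ∷ I) ⟧ weight m (outside ∷ inside ∷ I)
           + ∑[ I ← A ] ⟦ admissible? (outside ∷ outside ∷ I) ⟧ weight m (outside ∷ outside ∷ I))
        ≈⟨ +-congˡ (+-cong
             (∑-zero A (λ I → ⟦⟧-false (admissible? (outside ∷ inside ∷ I))
                                       {weight m (outside ∷ inside ∷ I)} ¬admissible-outside-inside))
             (∑-cong A (λ I → ⟦⟧-cong (admissible? (outside ∷ outside ∷ I)) (admissible? I)
                                      admissible-outside² refl))) ⟩
      m 0 * t * admissibleSum (suc n) (m ∘ suc) + (0# + admissibleSum n (m ∘ suc ∘ suc))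
        ≈⟨ +-congˡ (+-identityˡ _) ⟩
      m 0 * t * admissibleSum (suc n) (m ∘ suc) + admissibleSum n (m ∘ suc ∘ suc) ∎
      where A = allSubsets n

    f-0 : ∀ m → f R t m 0 ≈ 1#
    f-0 m = trans (f≈admissibleSum m 0) (admissibleSum-0 m)

    f-1 : ∀ m → f R t m 1 ≈ m 0 * t
    f-1 m = trans (f≈admissibleSum m 1) (admissibleSum-1 m)

    f-front : ∀ n m → f R t m (suc (suc n))
                        ≈ m 0 * t * f R t (m ∘ suc) (suc n) + f R t (m ∘ suc ∘ suc) n
    f-front n m = begin
      f R t m (suc (suc n))             ≈⟨ f≈admissibleSum m (suc (suc n)) ⟩
      admissibleSum (suc (suc n)) m     ≈⟨ admissibleSum-front n m ⟩
      m 0 * t * admissibleSum (suc n) (m ∘ suc) + admissibleSum n (m ∘ suc ∘ suc)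
        ≈⟨ +-cong (*-congˡ (f≈admissibleSum (m ∘ suc) (suc n))) (f≈admissibleSum (m ∘ suc ∘ suc) n) ⟨
      m 0 * t * f R t (m ∘ suc) (suc n) + f R t (m ∘ suc ∘ suc) n ∎

mainTheorem4 : {c ℓ : Level} (R : CommutativeRing c ℓ) →
    let open CommutativeRing R in
    (t : Carrier) (m : ℕ → Carrier) →
      (f R t m 0 ≈ 1#)
      × (f R t m 1 ≈ m 0 * t)
      × ((n : ℕ) → 1 ≤ n → f R t m (suc n) ≈ m n * t * f R t m n + f R t m (n ∸ 1))
mainTheorem4 R t m = f-0 R t m , f-1 R t m , λ { (suc n) _ → K-back n m }
  where open Continuant R t (λ n m → f R t m n) (f-0 R t) (f-1 R t) (f-front R t)
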